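{- Let $I$ be a problem, $0$ an agent with $C_0=C_1*C_2$ for Plott choice functions $C_1,C_2$ on $E(0)$, $M=N\setminus\{0\}$, and let $\widetilde I$, $\pi$ be the modified problem and projection described in the context. Let $\widetilde S,\widetilde T$ be stable sets of $\widetilde I$, $S=\pi(\widetilde S)$, $T=\pi(\widetilde T)$, and $m\in M$. If $\widetilde C_{\widetilde m}(\widetilde S(\widetilde m)\cup\widetilde T(\widetilde m))\subseteq\widetilde T(\widetilde m)$, then $C_m(S(m)\cup T(m))\subseteq T(m)$.
   Context: All sets are finite. A choice function (CF) on a set $X$ is a map $C:2^X\to 2^X$ with $C(A)\subseteq A$. It is a Plott CF if it is consistent ($C(A)\subseteq B\subseteq A\Rightarrow C(B)=C(A)$) and substitutable ($B\subseteq A\Rightarrow C(A)\cap B\subseteq C(B)$). For CFs $F,G$ on the same set, $(F*G)(A)=F(A)\cup G(A\setminus F(A))$. A problem consists of a finite set $N$ of agents, a finite set $E$ of contracts, for each $e\in E$ a set $P(e)\subseteq N$ of participants, and for each $a\in N$ a Plott CF $C_a$ on $E(a)=\{e\in E: a\in P(e)\}$. For $S\subseteq E$ write $S(a)=S\cap E(a)$. $S$ is stable if (1) $C_a(S(a))=S(a)$ for all $a\in N$, and (2) every $e\in E$ such that $e\in C_a(S(a)\cup\{e\})$ for all $a\in P(e)$ belongs to $S$. Modified problem $\widetilde I$: Let $R=E\setminus E(0)$. Contracts: $\widetilde E=R\sqcup\{e_1: e\in E(0)\}\sqcup\{e_2:e\in E(0)\}$, with $\pi(r)=r$ for $r\in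 R$ and $\pi(e_i)=e$. Agents: $1,2$ and $\widetilde m$ for each $m\in M$. Participants: for $r\in R$, $\{\widetilde m: m\in P(r)\}$; for $e_i$, $\{i\}\cup\{\widetilde m: m\in P(e)\setminus\{0\}\}$. Thus $\widetilde E(i)=\{e_i:e\in E(0)\}$ and $\widetilde E(\widetilde m)=\pi^{ -1}(E(m))$; $\widetilde S(\widetilde a)=\widetilde S\cap\widetilde E(\widetilde a)$. The CF of agent $i\in\{1,2\}$ is $\widetilde C_i(B)=\{e_i: e\in C_i(\pi(B))\}$. The CF of $\widetilde m$: for $B\subseteq\widetilde E(\widetilde m)$, $\widetilde C_{\widetilde m}(B)$ consists, for each $x\in C_m(\pi(B))$, of $x$ if $x\in R$, and, if $x\in E(0)$, of $x_1$ when $x_1\in B$ and of $x_2$ otherwise. -}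

module Defs where

open import Data.Bool using (Bool; true; false; T; not; _∧_; _∨_)
open import Data.Unit using (tt)
open import Data.Nat using (ℕ)
import Data.Nat as ℕ
open import Data.Fin using (Fin; zero; suc; _≟_)
open import Data.Product using (_×_; _,_)
open import Data.Sum using (_⊎_; inj₁; inj₂; [_,_])
open import Relation.Nullary using (yes; no)
open import Relation.Nullary.Decidable using (⌊_⌋)
open import Relation.Binary.Definitions using (DecidableEquality)
open import Relation.Binary.PropositionalEquality using (_≡_; refl; cong)

Sub : Set → Set
Sub X = X → Bool

module _ {X : Set} where

  infixr 6 _∩_
  infixr 5 _∪_ _─_
  infix 4 _∈_ _⊆_ _≐_

  ∅ : Sub X
  ∅ _ = false

  _∪_ : Sub X → Sub X → Sub X
  (A ∪ B) x = A x ∨ B x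

  _∩_ : Sub X → Sub X → Sub X
  (A ∩ B) x = A x ∧ B x

  _─_ : Sub X → Sub X → Sub X
  (A ─ B) x = A x ∧ not (B x)

  _∈_ : X → Sub X → Set
  x ∈ A = T (A x)

  _⊆_ : Sub X → Sub X → Set
  A ⊆ B = ∀ x → x ∈ A → x ∈ B

  _≐_ : Sub X → Sub X → Set
  A ≐ B = ∀ x → A x ≡ B x

  sing : DecidableEquality X → X → Sub X
  sing eq y x = ⌊ eq x y ⌋


-- A choice function on a subset D of X is modelled as
-- a map CF X = Sub X → Sub X; only its values on subsets of D matter,
-- and all conditions are imposed for subsets of D only.

CF : Set → Set
CF X = Sub X → Sub X

module _ {X : Set} (D : Sub X) (C : CF X) where

  IsCFOn : Set
  IsCFOn = ∀ A → A ⊆ D → C A ⊆ A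

  ConsistentOn : Set
  ConsistentOn = ∀ A B → A ⊆ D → C A ⊆ B → B ⊆ A → C B ≐ C A

  SubstitutableOn : Set
  SubstitutableOn = ∀ A B → A ⊆ D → B ⊆ A → C A ∩ B ⊆ C B

  PlottOn : Set
  PlottOn = IsCFOn × ConsistentOn × SubstitutableOn

_*_ : {X : Set} → CF X → CF X → CF X
(F * G) A = F A ∪ G (A ─ F A)

record Problem : Set₁ where
  field
    Agent    : Set
    Contract : Set
    decC     : DecidableEquality Contract
    P        : Contract → Sub Agent
    C        : Agent → CF Contract            -- C a is a CF on E(a)

  Eof : Agent → Sub Contract
  Eof a e = P e a

  _at_ : Sub Contract → Agent → Sub Contract
  S at a = S ∩ Eof a


Stable : (I : Problem) → Sub (Problem.Contract I) → Set
Stable I S =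
    (∀ a → C a (S at a) ≐ S at a)
  × (∀ e → (∀ a → a ∈ P e → e ∈ C a ((S at a) ∪ sing decC e)) → e ∈ S)
  where
    open Problem I

-- The modified problem.  The original problem has agents Fin (ℕ.suc k)
-- (agent 0 = zero, M = { suc m : m : Fin k }) and contracts Fin n.

T-irr : ∀ b (p q : T b) → p ≡ q
T-irr true _ _ = refl

split : (b : Bool) → T b ⊎ T (not b)
split true  = inj₁ tt
split false = inj₂ tt

module Contracts {k n : ℕ} (P : Fin n → Sub (Fin (ℕ.suc k))) where

  data Ẽ : Set where
    rc : (e : Fin n) → T (not (P e zero)) → Ẽ
    c₁ : (e : Fin n) → T (P e zero) → Ẽ
    c₂ : (e : Fin n) → T (P e zero) → Ẽ

  π : Ẽ → Fin n
  π (rc e _) = e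
  π (c₁ e _) = e
  π (c₂ e _) = e

  _≟Ẽ_ : DecidableEquality Ẽ
  rc e p ≟Ẽ rc e' p' with e ≟ e'
  ... | yes refl = yes (cong (rc e) (T-irr _ p p'))
  ... | no ne = no λ { refl → ne refl }
  c₁ e p ≟Ẽ c₁ e' p' with e ≟ e'
  ... | yes refl = yes (cong (c₁ e) (T-irr _ p p'))
  ... | no ne = no λ { refl → ne refl }
  c₂ e p ≟Ẽ c₂ e' p' with e ≟ e'
  ... | yes refl = yes (cong (c₂ e) (T-irr _ p p'))
  ... | no ne = no λ { refl → ne refl }
  rc _ _ ≟Ẽ c₁ _ _ = no λ ()
  rc _ _ ≟Ẽ c₂ _ _ = no λ ()
  c₁ _ _ ≟Ẽ rc _ _ = no λ ()
  c₁ _ _ ≟Ẽ c₂ _ _ = no λ ()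
  c₂ _ _ ≟Ẽ rc _ _ = no λ ()
  c₂ _ _ ≟Ẽ c₁ _ _ = no λ ()

  -- image π(B) of a set B ⊆ Ẽ, computed via the fibres of π:
  -- π⁻¹(e) = {e₁, e₂} if e ∈ E(0), and {e} otherwise.
  πS : Sub Ẽ → Sub (Fin n)
  πS B e = [ (λ p → B (c₁ e p) ∨ B (c₂ e p)) , (λ q → B (rc e q)) ] (split (P e zero))

  data Ñ : Set where
    ag₁ ag₂ : Ñ
    ag~ : Fin k → Ñ

  P̃ : Ẽ → Sub Ñ
  P̃ (rc e _) ag₁ = false
  P̃ (rc e _) ag₂ = false
  P̃ (rc e _) (ag~ m) = P e (suc m)
  P̃ (c₁ e _) ag₁ = true
  P̃ (c₁ e _) ag₂ = false
  P̃ (c₁ e _) (ag~ m) = P e (suc m)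
  P̃ (c₂ e _) ag₁ = false
  P̃ (c₂ e _) ag₂ = true
  P̃ (c₂ e _) (ag~ m) = P e (suc m)

module Modified {k n : ℕ} (P : Fin n → Sub (Fin (ℕ.suc k)))
                (C : Fin (ℕ.suc k) → CF (Fin n)) (C₁ C₂ : CF (Fin n)) where

  open Contracts P

  C̃ : Ñ → CF Ẽ
  C̃ ag₁ B (c₁ e _) = C₁ (πS B) e
  C̃ ag₁ B (c₂ e _) = false
  C̃ ag₁ B (rc e _) = false
  C̃ ag₂ B (c₂ e _) = C₂ (πS B) e
  C̃ ag₂ B (c₁ e _) = false
  C̃ ag₂ B (rc e _) = false
  C̃ (ag~ m) B (rc e _) = C (suc m) (πS B) e
  C̃ (ag~ m) B (c₁ e p) = C (suc m) (πS B) e ∧ B (c₁ e p)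
  C̃ (ag~ m) B (c₂ e p) = C (suc m) (πS B) e ∧ not (B (c₁ e p))

  Ĩ : Problem
  Ĩ = record
    { Agent = Ñ ; Contract = Ẽ ; decC = _≟Ẽ_ ; P = P̃ ; C = C̃ }

Orig : ∀ {k n} → (Fin n → Sub (Fin (ℕ.suc k))) → (Fin (ℕ.suc k) → CF (Fin n)) → Problem
Orig {k} {n} P C = record
  { Agent = Fin (ℕ.suc k) ; Contract = Fin n ; decC = _≟_ ; P = P ; C = C }

-- Projection commutes with restriction to an agent m̃ and with unions, so π maps
-- S̃(m̃) ∪ T̃(m̃) onto S(m) ∪ T(m). By construction C̃_m̃(B) contains a copy of every
-- contract of C_m(π(B)), so each x ∈ C_m(S(m) ∪ T(m)) has a copy in
-- C̃_m̃(S̃(m̃) ∪ T̃(m̃)) ⊆ T̃, whence x ∈ T.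
module Submission where

open import Defs
open import Algebra.Bundles using (CommutativeMonoid)
open import Data.Bool using (true; false; T; _∧_; _∨_)
open import Data.Bool.Properties using (T-∧; T-∨; ∧-distribʳ-∨; ∨-commutativeMonoid)
open import Algebra.Properties.CommutativeSemigroup
  (CommutativeMonoid.commutativeSemigroup ∨-commutativeMonoid)
  using (interchange)
open import Data.Fin using (Fin; zero; suc)
import Data.Nat as ℕ
open import Data.Product using (_,_; proj₁; proj₂)
open import Data.Sum using (inj₁; inj₂)
import Data.Sum as Sum
open import Function.Base using (_∘′_)
open import Function.Bundles using (Equivalence)
open import Relation.Binary.PropositionalEquality
  using (refl; sym; trans; cong₂; subst)

open Equivalence using (to; from)

module _ {X : Set} where

  ≐⇒⊆ : {A B : Sub X} → A ≐ B → A ⊆ B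
  ≐⇒⊆ A≐B x = subst T (A≐B x)

  ≐-sym : {A B : Sub X} → A ≐ B → B ≐ A
  ≐-sym A≐B x = sym (A≐B x)

  ∩-∪-∩-⊆ʳ : (A B D : Sub X) → (A ∩ D) ∪ (B ∩ D) ⊆ D
  ∩-∪-∩-⊆ʳ A B D x x∈ with T-∨ {A x ∧ D x} .to x∈
  ... | inj₁ x∈A∩D = proj₂ (T-∧ {A x} .to x∈A∩D)
  ... | inj₂ x∈B∩D = proj₂ (T-∧ {B x} .to x∈B∩D)

  -- Consistency is what makes a choice function blind to the intensional
  -- presentation of its argument (there is no function extensionality here).
  consistent⇒resp-≐ : {D : Sub X} {C : CF X} → IsCFOn D C → ConsistentOn D C →
                      ∀ {A B} → A ⊆ D → A ≐ B → C A ≐ C B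
  consistent⇒resp-≐ isCF consistent {A} {B} A⊆D A≐B =
    ≐-sym (consistent A B A⊆D (λ x x∈CA → ≐⇒⊆ A≐B x (isCF A A⊆D x x∈CA))
                              (≐⇒⊆ (≐-sym A≐B)))

module _ {k n : ℕ.ℕ} (P : Fin n → Sub (Fin (ℕ.suc k))) where

  open Contracts P

  Ẽof : Fin k → Sub Ẽ
  Ẽof m ẽ = P̃ ẽ (ag~ m)

  πS-mono : {A B : Sub Ẽ} → A ⊆ B → πS A ⊆ πS B
  πS-mono {A} {B} A⊆B e with split (P e zero)
  ... | inj₁ p = T-∨ {B (c₁ e p)} .from ∘′ Sum.map (A⊆B (c₁ e p)) (A⊆B (c₂ e p))
                                      ∘′ T-∨ {A (c₁ e p)} .to
  ... | inj₂ q = A⊆B (rc e q)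

  πS-∪ : (A B : Sub Ẽ) → πS (A ∪ B) ≐ πS A ∪ πS B
  πS-∪ A B e with split (P e zero)
  ... | inj₁ p = interchange (A (c₁ e p)) (B (c₁ e p)) (A (c₂ e p)) (B (c₂ e p))
  ... | inj₂ q = refl

  πS-∩-Ẽof : (B : Sub Ẽ) (m : Fin k) → πS (B ∩ Ẽof m) ≐ πS B ∩ (λ e → P e (suc m))
  πS-∩-Ẽof B m e with split (P e zero)
  ... | inj₁ p = sym (∧-distribʳ-∨ (P e (suc m)) (B (c₁ e p)) (B (c₂ e p)))
  ... | inj₂ q = refl

  πS-∪-∩-Ẽof : (A B : Sub Ẽ) (m : Fin k) →
               πS ((A ∩ Ẽof m) ∪ (B ∩ Ẽof m))
                 ≐ (πS A ∩ (λ e → P e (suc m))) ∪ (πS B ∩ (λ e → P e (suc m)))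
  πS-∪-∩-Ẽof A B m e =
    trans (πS-∪ (A ∩ Ẽof m) (B ∩ Ẽof m) e)
          (cong₂ _∨_ (πS-∩-Ẽof A m e) (πS-∩-Ẽof B m e))

  module _ (C : Fin (ℕ.suc k) → CF (Fin n)) (C₁ C₂ : CF (Fin n)) where

    open Modified P C C₁ C₂

    C-⊆-πS-C̃ : (m : Fin k) (B : Sub Ẽ) → C (suc m) (πS B) ⊆ πS (C̃ (ag~ m) B)
    C-⊆-πS-C̃ m B e e∈C with split (P e zero)
    ... | inj₂ q = e∈C
    ... | inj₁ p with B (c₁ e p)
    ...   | true  = T-∨ .from (inj₁ (T-∧ .from (e∈C , _)))
    ...   | false = T-∨ .from (inj₂ (T-∧ .from (e∈C , _)))

proposition3 :
  ∀ {k n} (P : Fin n → Sub (Fin (ℕ.suc k))) (C : Fin (ℕ.suc k) → CF (Fin n))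
    (C₁ C₂ : CF (Fin n)) →
    (∀ a → PlottOn (Problem.Eof (Orig P C) a) (C a)) →
    PlottOn (Problem.Eof (Orig P C) zero) C₁ →
    PlottOn (Problem.Eof (Orig P C) zero) C₂ →
    (∀ A → A ⊆ Problem.Eof (Orig P C) zero → C zero A ≐ (C₁ * C₂) A) →
    (S̃ T̃ : Sub (Contracts.Ẽ P)) →
    Stable (Modified.Ĩ P C C₁ C₂) S̃ →
    Stable (Modified.Ĩ P C C₁ C₂) T̃ →
    (m : Fin k) →
    Modified.C̃ P C C₁ C₂ (Contracts.ag~ m)
        (Problem._at_ (Modified.Ĩ P C C₁ C₂) S̃ (Contracts.ag~ m)
          ∪ Problem._at_ (Modified.Ĩ P C C₁ C₂) T̃ (Contracts.ag~ m))
      ⊆ Problem._at_ (Modified.Ĩ P C C₁ C₂) T̃ (Contracts.ag~ m) →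
    C (suc m) (Problem._at_ (Orig P C) (Contracts.πS P S̃) (suc m)
                ∪ Problem._at_ (Orig P C) (Contracts.πS P T̃) (suc m))
      ⊆ Problem._at_ (Orig P C) (Contracts.πS P T̃) (suc m)
proposition3 P C C₁ C₂ plott _ _ _ S̃ T̃ _ _ m C̃A⊆T̃ x x∈CX =
  T-∧ {πS T̃ x} .from (x∈πT̃ , ∩-∪-∩-⊆ʳ (πS S̃) (πS T̃) Em x (isCF X X⊆Em x x∈CX))
  where
    open Contracts P
    open Modified P C C₁ C₂
    Em : Sub (Fin _)
    Em e = P e (suc m)
    A : Sub Ẽ
    A = (S̃ ∩ Ẽof P m) ∪ (T̃ ∩ Ẽof P m)
    X : Sub (Fin _)
    X = (πS S̃ ∩ Em) ∪ (πS T̃ ∩ Em)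
    isCF : IsCFOn Em (C (suc m))
    isCF = proj₁ (plott (suc m))
    X⊆Em : X ⊆ Em
    X⊆Em = ∩-∪-∩-⊆ʳ (πS S̃) (πS T̃) Em
    x∈CπA : x ∈ C (suc m) (πS A)
    x∈CπA = ≐⇒⊆ (consistent⇒resp-≐ isCF (proj₁ (proj₂ (plott (suc m)))) X⊆Em
                   (≐-sym (πS-∪-∩-Ẽof P S̃ T̃ m))) x x∈CX
    x∈πT̃ : x ∈ πS T̃
    x∈πT̃ = πS-mono P {C̃ (ag~ m) A} (λ ẽ ẽ∈ → proj₁ (T-∧ {T̃ ẽ} .to (C̃A⊆T̃ ẽ ẽ∈)))
             x (C-⊆-πS-C̃ P C C₁ C₂ m A x x∈CπA)
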